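{- For integers $0\le s\le r$, let $h(s,r)=(h_0,h_1,h_2,\dots)$ be the sequence with $h_0=2^{ -(r+s)}$, $h_k=3\cdot2^{2k-2}/2^{r+s}$ for $1\le k\le s$, $h_k=2^{s+k-1}/2^{r+s}$ for $s+1\le k\le r$, and $h_k=0$ for $k>r$ (equivalently, $h_k$ is the proportion of points $P$ in any group $\mathbb{Z}/2^st\mathbb{Z}\oplus\mathbb{Z}/2^rw\mathbb{Z}$, with $t,w$ odd and $2^st\mid 2^rw$, such that $\nu_2(\mathrm{ord}(P))=k$). Among all integers $s_1,r_1,s_2,r_2$ with $0\le s_1\le r_1$, $0\le s_2\le r_2$ and $r_1\ge 1$, the dot product $h(s_1,r_1)\cdot h(s_2,r_2)=\sum_{k\ge0}h_k(s_1,r_1)h_k(s_2,r_2)$ is maximized when $r_1=r_2=s_1=s_2=1$.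
   Context: $\nu_2$ denotes the 2-adic valuation. -}

module Defs where

open import Data.Nat as ℕ using (ℕ; zero; suc; _+_; _*_; _^_; _≤ᵇ_)
open import Data.Nat.Properties using (m^n≢0)
open import Data.Bool using (if_then_else_)
open import Data.Integer using (+_)
open import Data.Rational as ℚ using (ℚ; _/_; 0ℚ)
open import Data.List using (List; map; foldr; upTo)

-- 2^(r+s) * h_k(s,r), a natural number:
--   k = 0        : 1
--   1 ≤ k ≤ s    : 3 * 2^(2k-2)
--   s < k ≤ r    : 2^(s+k-1)
--   k > r        : 0
hNum : ℕ → ℕ → ℕ → ℕ
hNum s r zero    = 1
hNum s r (suc j) =
  if suc j ≤ᵇ s then 3 * 2 ^ (2 * j)
  else if suc j ≤ᵇ r then 2 ^ (s + j)
  else 0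

h : ℕ → ℕ → ℕ → ℚ
h s r k = _/_ (+ hNum s r k) (2 ^ (r + s)) {{m^n≢0 2 (r + s)}}

sumℚ : List ℚ → ℚ
sumℚ = foldr ℚ._+_ 0ℚ

-- h(s₁,r₁) · h(s₂,r₂) = Σ_{k ≥ 0} h_k(s₁,r₁) h_k(s₂,r₂).
-- All terms with k > r₁ vanish, so summing over k = 0 … r₁ + r₂ is the full sum.
dot : ℕ → ℕ → ℕ → ℕ → ℚ
dot s₁ r₁ s₂ r₂ = sumℚ (map (λ k → h s₁ r₁ k ℚ.* h s₂ r₂ k) (upTo (suc (r₁ + r₂))))

-- For r ≥ 1 the squared norm ‖h(s,r)‖² = Σₖ hₖ² is at most 5/8, with equality at s = r = 1.
-- Scaled by 4^(r+s), the first s + 1 squares sum to (9·16^s + 6)/15, at most 5/8 of 16^s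
-- once s ≥ 1, and each later square 4^(s+k−1) is absorbed by the fourfold growth of the
-- bound from one k to the next. Termwise AM–GM then gives
-- h(s₁,r₁)·h(s₂,r₂) ≤ (‖h(s₁,r₁)‖² + ‖h(s₂,r₂)‖²)/2 ≤ 5/8 = h(1,1)·h(1,1), except when
-- r₂ = 0: then h(0,0) = (1,0,0,…) and the dot product is 2^−(r₁+s₁) ≤ 1/2.

module Submission where

open import Defs
open import Data.Nat using (ℕ; _≤_)
open import Data.Rational using () renaming (_≤_ to _≤ℚ_)

open import Data.Bool using (true; false)
import Data.Integer as ℤ
import Data.Integer.Properties as ℤₚ
open import Data.List using ([]; _∷_; _++_; map; upTo; applyUpTo)
open import Data.List.Properties using (applyUpTo-∷ʳ; map-upTo)
open import Data.Nat as ℕ using (zero; suc; _+_; _*_; _^_; _<_; NonZero; z≤n; s≤s; _≤′_; ≤′-refl; ≤′-step)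
open import Data.Nat.ListAction using (sum)
open import Data.Nat.ListAction.Properties using (sum-++)
open import Data.Nat.Properties
open import Algebra.Properties.CommutativeSemigroup +-commutativeSemigroup using (interchange)
open import Data.Nat.Tactic.RingSolver using (solve-∀)
open import Data.Product using (_,_)
open import Data.Sum using (inj₁; inj₂)
open import Data.Rational as ℚ using (ℚ; toℚᵘ)
import Data.Rational.Properties as ℚₚ
open import Data.Rational.Unnormalised as ℚᵘ using (ℚᵘ; mkℚᵘ; *≡*; *≤*)
import Data.Rational.Unnormalised.Properties as ℚᵘₚ
open import Function using (_∘_)
open import Relation.Binary.PropositionalEquality
open import Relation.Nullary.Reflects using (ofʸ; ofⁿ)
open import Relation.Nullary.Negation using (contradiction)

∑ : ℕ → (ℕ → ℕ) → ℕ
∑ n f = sum (applyUpTo f n)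

∑-suc : ∀ n f → ∑ (suc n) f ≡ ∑ n f + f n
∑-suc n f = begin
  sum (applyUpTo f (suc n))        ≡⟨ cong sum (applyUpTo-∷ʳ f n) ⟨
  sum (applyUpTo f n ++ f n ∷ [])  ≡⟨ sum-++ (applyUpTo f n) (f n ∷ []) ⟩
  ∑ n f + (f n + 0)                ≡⟨ cong (∑ n f +_) (+-identityʳ (f n)) ⟩
  ∑ n f + f n                      ∎
  where open ≡-Reasoning


∑-+ : ∀ n f g → ∑ n (λ k → f k + g k) ≡ ∑ n f + ∑ n g
∑-+ zero    f g = refl
∑-+ (suc n) f g = begin
  f 0 + g 0 + ∑ n (λ k → f (suc k) + g (suc k))  ≡⟨ cong (f 0 + g 0 +_) (∑-+ n (f ∘ suc) (g ∘ suc)) ⟩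
  f 0 + g 0 + (∑ n (f ∘ suc) + ∑ n (g ∘ suc))    ≡⟨ interchange (f 0) (g 0) _ _ ⟩
  ∑ (suc n) f + ∑ (suc n) g                      ∎
  where open ≡-Reasoning

∑-*ˡ : ∀ n c f → ∑ n (λ k → c * f k) ≡ c * ∑ n f
∑-*ˡ zero    c f = sym (*-zeroʳ c)
∑-*ˡ (suc n) c f = begin
  c * f 0 + ∑ n (λ k → c * f (suc k))  ≡⟨ cong (c * f 0 +_) (∑-*ˡ n c (f ∘ suc)) ⟩
  c * f 0 + c * ∑ n (f ∘ suc)          ≡⟨ *-distribˡ-+ c (f 0) _ ⟨
  c * ∑ (suc n) f                      ∎
  where open ≡-Reasoning

∑-mono-≤ : ∀ n {f g} → (∀ k → f k ≤ g k) → ∑ n f ≤ ∑ n g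
∑-mono-≤ zero    f≤g = z≤n
∑-mono-≤ (suc n) f≤g = +-mono-≤ (f≤g 0) (∑-mono-≤ n (f≤g ∘ suc))

∑-vanishing : ∀ m d f → (∀ k → m ≤ k → f k ≡ 0) → ∑ (m + d) f ≡ ∑ m f
∑-vanishing m zero    f f≥m≡0 = cong (λ n → ∑ n f) (+-identityʳ m)
∑-vanishing m (suc d) f f≥m≡0 = begin
  ∑ (m + suc d) f          ≡⟨ cong (λ n → ∑ n f) (+-suc m d) ⟩
  ∑ (suc (m + d)) f        ≡⟨ ∑-suc (m + d) f ⟩
  ∑ (m + d) f + f (m + d)  ≡⟨ cong₂ _+_ (∑-vanishing m d f f≥m≡0) (f≥m≡0 (m + d) (m≤m+n m d)) ⟩
  ∑ m f + 0                ≡⟨ +-identityʳ _ ⟩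
  ∑ m f                    ∎
  where open ≡-Reasoning

≤-induction : ∀ {ℓ} (P : ℕ → Set ℓ) {a b} → a ≤ b → P a →
              (∀ {j} → a ≤ j → j < b → P j → P (suc j)) → P b
≤-induction P a≤b = go (≤⇒≤′ a≤b)
  where
  go : ∀ {a b} → a ≤′ b → P a → (∀ {j} → a ≤ j → j < b → P j → P (suc j)) → P b
  go ≤′-refl        Pa step = Pa
  go (≤′-step a≤′b) Pa step =
    step (≤′⇒≤ a≤′b) ≤-refl (go a≤′b Pa (λ a≤j j<b → step a≤j (m≤n⇒m≤1+n j<b)))

2x[x+d]≤x²+[x+d]² : ∀ x d → 2 * x * (x + d) ≤ x * x + (x + d) * (x + d)
2x[x+d]≤x²+[x+d]² x d = subst (2 * x * (x + d) ≤_) (square-gap x d) (m≤m+n _ (d * d))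
  where
  square-gap : ∀ x d → 2 * x * (x + d) + d * d ≡ x * x + (x + d) * (x + d)
  square-gap = solve-∀

2xy≤x²+y² : ∀ x y → 2 * x * y ≤ x * x + y * y
2xy≤x²+y² x y with ≤-total x y
... | inj₁ x≤y with d , refl ← m≤n⇒∃[o]m+o≡n x≤y = 2x[x+d]≤x²+[x+d]² x d
... | inj₂ y≤x with d , refl ← m≤n⇒∃[o]m+o≡n y≤x =
  subst₂ _≤_ (swap y d) (+-comm (y * y) _) (2x[x+d]≤x²+[x+d]² y d)
  where
  swap : ∀ y d → 2 * y * (y + d) ≡ 2 * (y + d) * y
  swap = solve-∀

∑-2xy≤x²+y² : ∀ n (P Q : ℕ) (a b : ℕ → ℕ) →
  2 * P * Q * ∑ n (λ k → a k * b k) ≤ P * P * ∑ n (λ k → a k * a k) + Q * Q * ∑ n (λ k → b k * b k)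
∑-2xy≤x²+y² n P Q a b = begin
  2 * P * Q * ∑ n (λ k → a k * b k)                       ≡⟨ ∑-*ˡ n (2 * P * Q) _ ⟨
  ∑ n (λ k → 2 * P * Q * (a k * b k))                     ≤⟨ ∑-mono-≤ n termwise ⟩
  ∑ n (λ k → P * P * (a k * a k) + Q * Q * (b k * b k))   ≡⟨ ∑-+ n _ _ ⟩
  ∑ n (λ k → P * P * (a k * a k)) + ∑ n (λ k → Q * Q * (b k * b k))
    ≡⟨ cong₂ _+_ (∑-*ˡ n (P * P) _) (∑-*ˡ n (Q * Q) _) ⟩
  P * P * ∑ n (λ k → a k * a k) + Q * Q * ∑ n (λ k → b k * b k) ∎
  where
  open ≤-Reasoning
  regroupˡ : ∀ P Q a b → 2 * (P * a) * (Q * b) ≡ 2 * P * Q * (a * b)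
  regroupˡ = solve-∀
  regroupʳ : ∀ P Q a b → (P * a) * (P * a) + (Q * b) * (Q * b) ≡ P * P * (a * a) + Q * Q * (b * b)
  regroupʳ = solve-∀
  termwise : ∀ k → 2 * P * Q * (a k * b k) ≤ P * P * (a k * a k) + Q * Q * (b k * b k)
  termwise k = subst₂ _≤_ (regroupˡ P Q (a k) (b k)) (regroupʳ P Q (a k) (b k)) (2xy≤x²+y² (P * a k) (Q * b k))

∑-inner-bound : ∀ n (a b : ℕ → ℕ) {p q P Q} .{{_ : NonZero P}} .{{_ : NonZero Q}} →
  q * ∑ n (λ k → a k * a k) ≤ p * (P * P) → q * ∑ n (λ k → b k * b k) ≤ p * (Q * Q) →
  ∑ n (λ k → a k * b k) * q ≤ p * (P * Q)
∑-inner-bound n a b {p} {q} {P} {Q} qA≤pP² qB≤pQ² =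
  *-cancelˡ-≤ (2 * Q * P) {{m*n≢0 (2 * Q) P {{m*n≢0 2 Q}}}} (begin
    2 * Q * P * (S * q)                      ≡⟨ reorder (2 * Q * P) S q ⟩
    q * (2 * Q * P * S)                      ≤⟨ *-monoʳ-≤ q (∑-2xy≤x²+y² n Q P a b) ⟩
    q * (Q * Q * A + P * P * B)              ≡⟨ distribute q Q P A B ⟩
    Q * Q * (q * A) + P * P * (q * B)        ≤⟨ +-mono-≤ (*-monoʳ-≤ (Q * Q) qA≤pP²) (*-monoʳ-≤ (P * P) qB≤pQ²) ⟩
    Q * Q * (p * (P * P)) + P * P * (p * (Q * Q)) ≡⟨ collect p P Q ⟩
    2 * Q * P * (p * (P * Q))                ∎)
  where
  open ≤-Reasoning
  S A B : ℕ
  S = ∑ n (λ k → a k * b k)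
  A = ∑ n (λ k → a k * a k)
  B = ∑ n (λ k → b k * b k)
  reorder : ∀ x S q → x * (S * q) ≡ q * (x * S)
  reorder = solve-∀
  distribute : ∀ q Q P A B → q * (Q * Q * A + P * P * B) ≡ Q * Q * (q * A) + P * P * (q * B)
  distribute = solve-∀
  collect : ∀ p P Q → Q * Q * (p * (P * P)) + P * P * (p * (Q * Q)) ≡ 2 * Q * P * (p * (P * Q))
  collect = solve-∀

hNum-low : ∀ {s r j} → j < s → hNum s r (suc j) ≡ 3 * 2 ^ (2 * j)
hNum-low {s} {r} {j} j<s with suc j ℕ.≤ᵇ s | ≤ᵇ-reflects-≤ (suc j) s
... | true  | _        = refl
... | false | ofⁿ j≮s = contradiction j<s j≮s

hNum-mid : ∀ {s r j} → s ≤ j → j < r → hNum s r (suc j) ≡ 2 ^ (s + j)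
hNum-mid {s} {r} {j} s≤j j<r
  with suc j ℕ.≤ᵇ s | ≤ᵇ-reflects-≤ (suc j) s | suc j ℕ.≤ᵇ r | ≤ᵇ-reflects-≤ (suc j) r
... | true  | ofʸ j<s | _     | _        = contradiction j<s (≤⇒≯ s≤j)
... | false | _       | true  | _        = refl
... | false | _       | false | ofⁿ j≮r = contradiction j<r j≮r

hNum-high : ∀ {s r j} → s ≤ r → r ≤ j → hNum s r (suc j) ≡ 0
hNum-high {s} {r} {j} s≤r r≤j
  with suc j ℕ.≤ᵇ s | ≤ᵇ-reflects-≤ (suc j) s | suc j ℕ.≤ᵇ r | ≤ᵇ-reflects-≤ (suc j) r
... | true  | ofʸ j<s | _     | _        = contradiction j<s (≤⇒≯ (≤-trans s≤r r≤j))
... | false | _       | true  | ofʸ j<r  = contradiction j<r (≤⇒≯ r≤j)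
... | false | _       | false | _        = refl

hNumSq : ℕ → ℕ → ℕ → ℕ
hNumSq s r n = ∑ n (λ k → hNum s r k * hNum s r k)

2^[2+2i] : ∀ i → 2 ^ (2 * suc i) ≡ 4 * 2 ^ (2 * i)
2^[2+2i] i = begin
  2 ^ (2 * suc i)        ≡⟨ cong (2 ^_) (*-suc 2 i) ⟩
  2 * (2 * 2 ^ (2 * i))  ≡⟨ *-assoc 2 2 (2 ^ (2 * i)) ⟨
  4 * 2 ^ (2 * i)        ∎
  where open ≡-Reasoning

hNumSq-closedForm : ∀ {s} r i → i ≤ s → 15 * hNumSq s r (suc i) ≡ 9 * (2 ^ (2 * i) * 2 ^ (2 * i)) + 6
hNumSq-closedForm r zero    _    = refl
hNumSq-closedForm {s} r (suc i) 1+i≤s = begin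
  15 * hNumSq s r (suc (suc i))                    ≡⟨ cong (15 *_) (∑-suc (suc i) (λ k → hNum s r k * hNum s r k)) ⟩
  15 * (hNumSq s r (suc i) + hNum s r (suc i) * hNum s r (suc i))
    ≡⟨ *-distribˡ-+ 15 (hNumSq s r (suc i)) _ ⟩
  15 * hNumSq s r (suc i) + 15 * (hNum s r (suc i) * hNum s r (suc i))
    ≡⟨ cong₂ (λ x y → x + 15 * (y * y)) (hNumSq-closedForm r i (<⇒≤ 1+i≤s)) (hNum-low {r = r} 1+i≤s) ⟩
  9 * (u * u) + 6 + 15 * (3 * u * (3 * u))         ≡⟨ geometric u ⟩
  9 * (4 * u * (4 * u)) + 6                        ≡⟨ cong (λ x → 9 * (x * x) + 6) (2^[2+2i] i) ⟨
  9 * (2 ^ (2 * suc i) * 2 ^ (2 * suc i)) + 6      ∎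
  where
  open ≡-Reasoning
  u : ℕ
  u = 2 ^ (2 * i)
  geometric : ∀ u → 9 * (u * u) + 6 + 15 * (3 * u * (3 * u)) ≡ 9 * (4 * u * (4 * u)) + 6
  geometric = solve-∀

PartialNormBound : ℕ → ℕ → ℕ → Set
PartialNormBound s r j = 8 * hNumSq s r (suc j) ≤ 5 * (2 ^ (j + s) * 2 ^ (j + s))

partialNormBound-suc : ∀ {s r j} → s ≤ j → j < r → PartialNormBound s r j → PartialNormBound s r (suc j)
partialNormBound-suc {s} {r} {j} s≤j j<r bound = begin
  8 * hNumSq s r (suc (suc j))                          ≡⟨ cong (8 *_) (∑-suc (suc j) (λ k → hNum s r k * hNum s r k)) ⟩
  8 * (hNumSq s r (suc j) + hNum s r (suc j) * hNum s r (suc j))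
    ≡⟨ *-distribˡ-+ 8 (hNumSq s r (suc j)) _ ⟩
  8 * hNumSq s r (suc j) + 8 * (hNum s r (suc j) * hNum s r (suc j))
    ≡⟨ cong (λ x → 8 * hNumSq s r (suc j) + 8 * (x * x)) (trans (hNum-mid s≤j j<r) (cong (2 ^_) (+-comm s j))) ⟩
  8 * hNumSq s r (suc j) + 8 * (w * w)                  ≤⟨ +-monoˡ-≤ (8 * (w * w)) bound ⟩
  5 * (w * w) + 8 * (w * w)                             ≤⟨ m≤m+n _ (7 * (w * w)) ⟩
  5 * (w * w) + 8 * (w * w) + 7 * (w * w)               ≡⟨ quadruple w ⟩
  5 * (2 * w * (2 * w))                                 ∎
  where
  open ≤-Reasoning
  w : ℕ
  w = 2 ^ (j + s)
  quadruple : ∀ w → 5 * (w * w) + 8 * (w * w) + 7 * (w * w) ≡ 5 * (2 * w * (2 * w))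
  quadruple = solve-∀

partialNormBound-1 : ∀ {r} → 1 ≤ r → PartialNormBound 0 r 1
partialNormBound-1 1≤r =
  subst (λ x → 8 * (1 * 1 + (x * x + 0)) ≤ 20) (sym (hNum-mid z≤n 1≤r)) (m≤m+n 16 4)

partialNormBound-diagonal : ∀ s r → 1 ≤ s → PartialNormBound s r s
partialNormBound-diagonal s r 1≤s =
  subst (λ t → 8 * hNumSq s r (suc s) ≤ 5 * (2 ^ t * 2 ^ t)) (cong (s +_) (+-identityʳ s))
    (*-cancelˡ-≤ 15 (begin
      15 * (8 * hNumSq s r (suc s))   ≡⟨ swap (hNumSq s r (suc s)) ⟩
      8 * (15 * hNumSq s r (suc s))   ≡⟨ cong (8 *_) (hNumSq-closedForm r s ≤-refl) ⟩
      8 * (9 * (u * u) + 6)           ≡⟨ expand u ⟩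
      72 * (u * u) + 3 * (4 * 4)      ≤⟨ +-monoʳ-≤ (72 * (u * u)) (*-monoʳ-≤ 3 (*-mono-≤ 4≤u 4≤u)) ⟩
      72 * (u * u) + 3 * (u * u)      ≡⟨ collect u ⟩
      15 * (5 * (u * u))              ∎))
  where
  open ≤-Reasoning
  u : ℕ
  u = 2 ^ (2 * s)
  4≤u : 4 ≤ u
  4≤u = ^-monoʳ-≤ 2 (*-monoʳ-≤ 2 1≤s)
  swap : ∀ x → 15 * (8 * x) ≡ 8 * (15 * x)
  swap = solve-∀
  expand : ∀ u → 8 * (9 * (u * u) + 6) ≡ 72 * (u * u) + 3 * (4 * 4)
  expand = solve-∀
  collect : ∀ u → 72 * (u * u) + 3 * (u * u) ≡ 15 * (5 * (u * u))
  collect = solve-∀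

-- For s = 0 the partial bound fails at j = 0 (it would read 8 ≤ 5), so the induction starts at j = 1.
normBound : ∀ {s r} → s ≤ r → 1 ≤ r → PartialNormBound s r r
normBound {zero}  {r} _   1≤r = ≤-induction (PartialNormBound 0 r) 1≤r (partialNormBound-1 1≤r)
                                  (λ _ → partialNormBound-suc z≤n)
normBound {suc s} {r} s≤r _   = ≤-induction (PartialNormBound (suc s) r) s≤r
                                  (partialNormBound-diagonal (suc s) r (s≤s z≤n)) partialNormBound-suc

hNum²-vanishing : ∀ {s r} → s ≤ r → ∀ k → suc r ≤ k → hNum s r k * hNum s r k ≡ 0
hNum²-vanishing s≤r (suc j) (s≤s r≤j) = cong (λ x → x * x) (hNum-high s≤r r≤j)

hNumSq-bound : ∀ {s r} → s ≤ r → 1 ≤ r → ∀ d → 8 * hNumSq s r (suc r + d) ≤ 5 * (2 ^ (r + s) * 2 ^ (r + s))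
hNumSq-bound {s} {r} s≤r 1≤r d =
  subst (λ x → 8 * x ≤ 5 * (2 ^ (r + s) * 2 ^ (r + s)))
        (sym (∑-vanishing (suc r) d _ (hNum²-vanishing s≤r))) (normBound s≤r 1≤r)

dotNum : ℕ → ℕ → ℕ → ℕ → ℕ
dotNum s₁ r₁ s₂ r₂ = ∑ (suc (r₁ + r₂)) (λ k → hNum s₁ r₁ k * hNum s₂ r₂ k)

dotNum-bound : ∀ {s₁ r₁ s₂ r₂} → s₁ ≤ r₁ → s₂ ≤ r₂ → 1 ≤ r₁ →
               dotNum s₁ r₁ s₂ r₂ * 8 ≤ 5 * (2 ^ (r₁ + s₁) * 2 ^ (r₂ + s₂))
dotNum-bound {s₁} {r₁} {zero} {zero} _ _ 1≤r₁ = begin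
  dotNum s₁ r₁ 0 0 * 8  ≡⟨ cong (_* 8) (∑-vanishing 1 (r₁ + 0) _ vanishing) ⟩
  8                     ≤⟨ m≤m+n 8 2 ⟩
  5 * 2                 ≤⟨ *-monoʳ-≤ 5 (^-monoʳ-≤ 2 (≤-trans 1≤r₁ (m≤m+n r₁ s₁))) ⟩
  5 * 2 ^ (r₁ + s₁)     ≡⟨ cong (5 *_) (*-identityʳ (2 ^ (r₁ + s₁))) ⟨
  5 * (2 ^ (r₁ + s₁) * 1) ∎
  where
  open ≤-Reasoning
  vanishing : ∀ k → 1 ≤ k → hNum s₁ r₁ k * hNum 0 0 k ≡ 0
  vanishing (suc j) _ = *-zeroʳ (hNum s₁ r₁ (suc j))
dotNum-bound {s₁} {r₁} {s₂} {r₂@(suc _)} s₁≤r₁ s₂≤r₂ 1≤r₁ =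
  ∑-inner-bound (suc (r₁ + r₂)) (hNum s₁ r₁) (hNum s₂ r₂) {p = 5} {{m^n≢0 2 (r₁ + s₁)}} {{m^n≢0 2 (r₂ + s₂)}}
    (hNumSq-bound s₁≤r₁ 1≤r₁ r₂)
    (subst (λ n → 8 * hNumSq s₂ r₂ (suc n) ≤ 5 * (2 ^ (r₂ + s₂) * 2 ^ (r₂ + s₂)))
           (+-comm r₂ r₁) (hNumSq-bound s₂≤r₂ (s≤s z≤n) r₁))

infix 8 _÷_

_÷_ : ℕ → (d : ℕ) → .{{NonZero d}} → ℚᵘ
a ÷ d = ℤ.+ a ℚᵘ./ d

÷-≃ : ∀ a A b B .{{_ : NonZero A}} .{{_ : NonZero B}} → a * B ≡ b * A → a ÷ A ℚᵘ.≃ b ÷ B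
÷-≃ a A@(suc _) b B@(suc _) aB≡bA =
  *≡* (trans (sym (ℤₚ.pos-* a B)) (trans (cong ℤ.+_ aB≡bA) (ℤₚ.pos-* b A)))

÷-mono-≤ : ∀ a A b B .{{_ : NonZero A}} .{{_ : NonZero B}} → a * B ≤ b * A → a ÷ A ℚᵘ.≤ b ÷ B
÷-mono-≤ a A@(suc _) b B@(suc _) aB≤bA =
  *≤* (subst₂ ℤ._≤_ (ℤₚ.pos-* a B) (ℤₚ.pos-* b A) (ℤ.+≤+ aB≤bA))

÷-+ : ∀ a b D .{{_ : NonZero D}} → a ÷ D ℚᵘ.+ b ÷ D ℚᵘ.≃ (a + b) ÷ D
÷-+ a b D@(suc _) = begin
  a ÷ D ℚᵘ.+ b ÷ D            ≡⟨ cong (ℚᵘ._/ (D * D)) numerator ⟩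
  (a * D + b * D) ÷ (D * D)   ≈⟨ ÷-≃ _ (D * D) (a + b) D (cancel a b D) ⟩
  (a + b) ÷ D                 ∎
  where
  open ℚᵘₚ.≃-Reasoning
  numerator : ℤ.+ a ℤ.* ℤ.+ D ℤ.+ ℤ.+ b ℤ.* ℤ.+ D ≡ ℤ.+ (a * D + b * D)
  numerator = sym (trans (ℤₚ.pos-+ (a * D) (b * D)) (cong₂ ℤ._+_ (ℤₚ.pos-* a D) (ℤₚ.pos-* b D)))
  cancel : ∀ a b D → (a * D + b * D) * D ≡ (a + b) * (D * D)
  cancel = solve-∀

÷-* : ∀ a A b B .{{_ : NonZero A}} .{{_ : NonZero B}} →
      a ÷ A ℚᵘ.* b ÷ B ≡ _÷_ (a * b) (A * B) {{m*n≢0 A B}}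
÷-* a A@(suc _) b B@(suc _) = cong (ℚᵘ._/ (A * B)) (sym (ℤₚ.pos-* a b))

toℚᵘ-/ : ∀ a D .{{_ : NonZero D}} → toℚᵘ (ℤ.+ a ℚ./ D) ℚᵘ.≃ a ÷ D
toℚᵘ-/ a (suc d) = ℚₚ.toℚᵘ-fromℚᵘ (mkℚᵘ (ℤ.+ a) d)

toℚᵘ-sumℚ : ∀ (G : ℕ → ℚ) (F : ℕ → ℕ) D .{{_ : NonZero D}} → (∀ k → toℚᵘ (G k) ℚᵘ.≃ F k ÷ D) →
            ∀ xs → toℚᵘ (sumℚ (map G xs)) ℚᵘ.≃ sum (map F xs) ÷ D
toℚᵘ-sumℚ G F D G≃F÷D []       = ÷-≃ 0 1 0 D refl
toℚᵘ-sumℚ G F D G≃F÷D (x ∷ xs) = begin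
  toℚᵘ (G x ℚ.+ sumℚ (map G xs))             ≈⟨ ℚₚ.toℚᵘ-homo-+ (G x) _ ⟩
  toℚᵘ (G x) ℚᵘ.+ toℚᵘ (sumℚ (map G xs))     ≈⟨ ℚᵘₚ.+-cong (G≃F÷D x) (toℚᵘ-sumℚ G F D G≃F÷D xs) ⟩
  F x ÷ D ℚᵘ.+ sum (map F xs) ÷ D           ≈⟨ ÷-+ (F x) _ D ⟩
  (F x + sum (map F xs)) ÷ D                ∎
  where open ℚᵘₚ.≃-Reasoning

2^m*2^n≢0 : ∀ m n → NonZero (2 ^ m * 2 ^ n)
2^m*2^n≢0 m n = m*n≢0 (2 ^ m) (2 ^ n) {{m^n≢0 2 m}} {{m^n≢0 2 n}}

toℚᵘ-dot : ∀ s₁ r₁ s₂ r₂ →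
  toℚᵘ (dot s₁ r₁ s₂ r₂) ℚᵘ.≃ _÷_ (dotNum s₁ r₁ s₂ r₂) (2 ^ (r₁ + s₁) * 2 ^ (r₂ + s₂)) {{2^m*2^n≢0 (r₁ + s₁) (r₂ + s₂)}}
toℚᵘ-dot s₁ r₁ s₂ r₂ = begin
  toℚᵘ (dot s₁ r₁ s₂ r₂)                ≈⟨ toℚᵘ-sumℚ _ F D termwise (upTo (suc (r₁ + r₂))) ⟩
  sum (map F (upTo (suc (r₁ + r₂)))) ÷ D ≡⟨ cong (λ xs → sum xs ÷ D) (map-upTo F (suc (r₁ + r₂))) ⟩
  dotNum s₁ r₁ s₂ r₂ ÷ D                ∎
  where
  open ℚᵘₚ.≃-Reasoning
  instance
    D≢0 : NonZero (2 ^ (r₁ + s₁) * 2 ^ (r₂ + s₂))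
    D≢0 = 2^m*2^n≢0 (r₁ + s₁) (r₂ + s₂)
  D : ℕ
  D = 2 ^ (r₁ + s₁) * 2 ^ (r₂ + s₂)
  F : ℕ → ℕ
  F = λ k → hNum s₁ r₁ k * hNum s₂ r₂ k
  termwise : ∀ k → toℚᵘ (h s₁ r₁ k ℚ.* h s₂ r₂ k) ℚᵘ.≃ F k ÷ D
  termwise k = begin
    toℚᵘ (h s₁ r₁ k ℚ.* h s₂ r₂ k)          ≈⟨ ℚₚ.toℚᵘ-homo-* (h s₁ r₁ k) (h s₂ r₂ k) ⟩
    toℚᵘ (h s₁ r₁ k) ℚᵘ.* toℚᵘ (h s₂ r₂ k)  ≈⟨ ℚᵘₚ.*-cong (toℚᵘ-/ _ _ {{2^r₁+s₁≢0}}) (toℚᵘ-/ _ _ {{2^r₂+s₂≢0}}) ⟩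
    _÷_ (hNum s₁ r₁ k) _ {{2^r₁+s₁≢0}} ℚᵘ.* _÷_ (hNum s₂ r₂ k) _ {{2^r₂+s₂≢0}}
                                            ≡⟨ ÷-* _ _ _ _ {{2^r₁+s₁≢0}} {{2^r₂+s₂≢0}} ⟩
    F k ÷ D                                 ∎
    where
    2^r₁+s₁≢0 : NonZero (2 ^ (r₁ + s₁))
    2^r₁+s₁≢0 = m^n≢0 2 (r₁ + s₁)
    2^r₂+s₂≢0 : NonZero (2 ^ (r₂ + s₂))
    2^r₂+s₂≢0 = m^n≢0 2 (r₂ + s₂)

mainTheorem10 : (s₁ r₁ s₂ r₂ : ℕ) → s₁ ≤ r₁ → s₂ ≤ r₂ → 1 ≤ r₁ →
    dot s₁ r₁ s₂ r₂ ≤ℚ dot 1 1 1 1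
mainTheorem10 s₁ r₁ s₂ r₂ s₁≤r₁ s₂≤r₂ 1≤r₁ = ℚₚ.toℚᵘ-cancel-≤ (begin
  toℚᵘ (dot s₁ r₁ s₂ r₂)  ≃⟨ toℚᵘ-dot s₁ r₁ s₂ r₂ ⟩
  _÷_ (dotNum s₁ r₁ s₂ r₂) (2 ^ (r₁ + s₁) * 2 ^ (r₂ + s₂)) {{2^m*2^n≢0 (r₁ + s₁) (r₂ + s₂)}}
    ≤⟨ ÷-mono-≤ _ _ 5 8 {{2^m*2^n≢0 (r₁ + s₁) (r₂ + s₂)}} (dotNum-bound s₁≤r₁ s₂≤r₂ 1≤r₁) ⟩
  5 ÷ 8                    ≃⟨ ÷-≃ 5 8 10 16 refl ⟩
  10 ÷ 16                  ≃⟨ toℚᵘ-dot 1 1 1 1 ⟨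
  toℚᵘ (dot 1 1 1 1)      ∎)
  where open ℚᵘₚ.≤-Reasoning
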